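{- Call a finite string over the nonnegative integers simple if it contains a contiguous substring of the form $0\,1^j\,0$ for some $j\ge0$ (a $0$, then $j$ ones, then a $0$). Let $k\ge 0$ and let the weight of a string be the sum of its entries. Then: (i) every string over the nonnegative integers of weight $k$ and length at least $k+2$ is simple; (ii) if $A$ is a non-simple string over the nonnegative integers of weight $k$ and length $k+1$, then $A[1]\le1$, $A[k+1]\le1$, $A[i]\le2$ for all $2\le i\le k$, and there is no index $i$ with $A[i]=A[i+1]=2$. -}

module Defs where

open import Data.Nat using (ℕ)
open import Data.List using (List; _∷_; []; _++_; replicate)
open import Data.Product using (∃-syntax)
open import Relation.Binary.PropositionalEquality using (_≡_)

Simple : List ℕ → Set
Simple A = ∃[ u ] ∃[ v ] ∃[ j ] (A ≡ u ++ ((0 ∷ replicate j 1) ++ (0 ∷ [])) ++ v)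

-- In a non-simple string every 0 after the first needs
-- an entry ≥ 2 between it and the previous 0; such an entry contributes at
-- least one unit of weight beyond its length, which pays for that 0. Hence
-- length ≤ weight + 1. Equality forces every large entry to be exactly 2 and
-- to alternate strictly with the 0s, starting and ending with a 0-block, and
-- that shape gives the constraints of (ii).
module Submission where

open import Defs
open import Data.Nat using (ℕ; suc; zero; pred; _≤_; _<_; _+_; z≤n; s≤s)
open import Data.Nat.Properties
  using (+-suc; +-comm; ≤-refl; ≤-reflexive; ≤-trans; <⇒≤; <-irrefl; +-monoʳ-≤; +-monoˡ-≤;
         module ≤-Reasoning)
open import Data.Nat.Tactic.RingSolver using (solve-∀)
open import Data.List using (List; length; lookup; _∷_; []; _++_; replicate)
open import Data.List.Properties using (++-assoc)
open import Data.Nat.ListAction using (sum)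
open import Data.Fin using (Fin; toℕ) renaming (zero to fzero; suc to fsuc)
open import Data.Product using (_×_; _,_; ∃-syntax)
open import Data.Sum using (_⊎_; inj₁; inj₂; [_,_])
open import Data.Empty using (⊥-elim)
open import Relation.Nullary using (¬_)
open import Relation.Binary.PropositionalEquality using (_≡_; refl; cong; sym; trans)

OnesThenZero : List ℕ → Set
OnesThenZero L = ∃[ j ] ∃[ v ] (L ≡ replicate j 1 ++ 0 ∷ v)

-- pending: the string is preceded by 0 1^i, so a prefix 1^j 0 completes the pattern.
data Context : Set where
  pending clear : Context

SimpleIn : Context → List ℕ → Set
SimpleIn pending L = Simple L ⊎ OnesThenZero L
SimpleIn clear   L = Simple L

-- A clear context may still open with a 0 at no cost; a pending one may not.
spare : Context → ℕ
spare pending = 0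
spare clear   = 1

Slack : Context → List ℕ → Set
Slack c L = suc (length L) ≤ spare c + sum L

data Tight : Context → List ℕ → Set where
  []   : Tight pending []
  0∷_  : ∀ {L}   → Tight pending L → Tight clear (0 ∷ L)
  1∷_  : ∀ {c L} → Tight c L       → Tight c (1 ∷ L)
  2∷_  : ∀ {L}   → Tight clear L   → Tight pending (2 ∷ L)

Simple-∷ : ∀ x {L} → Simple L → Simple (x ∷ L)
Simple-∷ x (u , v , j , L≡) = x ∷ u , v , j , cong (x ∷_) L≡

OnesThenZero⇒Simple-0∷ : ∀ {L} → OnesThenZero L → Simple (0 ∷ L)
OnesThenZero⇒Simple-0∷ (j , v , L≡) =
  [] , v , j , cong (0 ∷_) (trans L≡ (sym (++-assoc (replicate j 1) (0 ∷ []) v)))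

Simple⇒SimpleIn : ∀ c {L} → Simple L → SimpleIn c L
Simple⇒SimpleIn pending = inj₁
Simple⇒SimpleIn clear   = λ s → s

SimpleIn-1∷ : ∀ c {L} → SimpleIn c L → SimpleIn c (1 ∷ L)
SimpleIn-1∷ pending (inj₁ s)             = inj₁ (Simple-∷ 1 s)
SimpleIn-1∷ pending (inj₂ (j , v , L≡)) = inj₂ (suc j , v , cong (1 ∷_) L≡)
SimpleIn-1∷ clear   s                    = Simple-∷ 1 s

tight-length : ∀ {c L} → Tight c L → length L ≡ spare c + sum L
tight-length []                  = refl
tight-length (0∷ t)              = cong suc (tight-length t)
tight-length {c} (1∷_ {L = L} t) = trans (cong suc (tight-length t)) (sym (+-suc (spare c) (sum L)))
tight-length (2∷ t)              = cong suc (tight-length t)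

Slack-1∷ : ∀ c L → Slack c L → Slack c (1 ∷ L)
Slack-1∷ c L h = ≤-trans (s≤s h) (≤-reflexive (sym (+-suc (spare c) (sum L))))

Tight⊎Slack⇒length≤ : ∀ {c L} → Tight c L ⊎ Slack c L → length L ≤ spare c + sum L
Tight⊎Slack⇒length≤ (inj₁ t) = ≤-reflexive (tight-length t)
Tight⊎Slack⇒length≤ (inj₂ h) = <⇒≤ h

-- An entry 2 + y has slack unless it is a 2 closing a pending 0.
Slack-big∷ : ∀ c y L → 1 ≤ spare c + y → length L ≤ 1 + sum L → Slack c (suc (suc y) ∷ L)
Slack-big∷ c y L 1≤ L≤ = begin
  2 + length L               ≤⟨ +-monoʳ-≤ 1 (s≤s L≤) ⟩
  1 + (2 + sum L)            ≤⟨ +-monoˡ-≤ (2 + sum L) 1≤ ⟩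
  (spare c + y) + (2 + sum L) ≡⟨ regroup (spare c) y (sum L) ⟩
  spare c + (2 + y + sum L)  ∎
  where
  open ≤-Reasoning
  regroup : ∀ a y s → (a + y) + (2 + s) ≡ a + (2 + y + s)
  regroup = solve-∀

Tight⊎Slack-big∷ : ∀ c y L → Tight clear L ⊎ Slack clear L
                 → Tight c (suc (suc y) ∷ L) ⊎ Slack c (suc (suc y) ∷ L)
Tight⊎Slack-big∷ pending zero    L (inj₁ t) = inj₁ (2∷ t)
Tight⊎Slack-big∷ pending zero    L (inj₂ h) = inj₂ (s≤s h)
Tight⊎Slack-big∷ pending (suc y) L r        = inj₂ (Slack-big∷ pending (suc y) L (s≤s z≤n) (Tight⊎Slack⇒length≤ r))
Tight⊎Slack-big∷ clear   y       L r        = inj₂ (Slack-big∷ clear y L (s≤s z≤n) (Tight⊎Slack⇒length≤ r))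

classify : ∀ c L → SimpleIn c L ⊎ Tight c L ⊎ Slack c L
classify pending []      = inj₂ (inj₁ [])
classify clear   []      = inj₂ (inj₂ ≤-refl)
classify pending (0 ∷ L) = inj₁ (inj₂ (0 , L , refl))
classify clear   (0 ∷ L) with classify pending L
... | inj₁ s        = inj₁ ([ Simple-∷ 0 , OnesThenZero⇒Simple-0∷ ] s)
... | inj₂ (inj₁ t) = inj₂ (inj₁ (0∷ t))
... | inj₂ (inj₂ h) = inj₂ (inj₂ (s≤s h))
classify c (1 ∷ L) with classify c L
... | inj₁ s        = inj₁ (SimpleIn-1∷ c s)
... | inj₂ (inj₁ t) = inj₂ (inj₁ (1∷ t))
... | inj₂ (inj₂ h) = inj₂ (inj₂ (Slack-1∷ c L h))
classify c (suc (suc y) ∷ L) with classify clear L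
... | inj₁ s = inj₁ (Simple⇒SimpleIn c (Simple-∷ _ s))
... | inj₂ r = inj₂ (Tight⊎Slack-big∷ c y L r)

Simple⊎length≤ : ∀ A → Simple A ⊎ length A ≤ suc (sum A)
Simple⊎length≤ A with classify clear A
... | inj₁ s = inj₁ s
... | inj₂ r = inj₂ (Tight⊎Slack⇒length≤ r)

¬Simple⇒extremal⇒Tight : ∀ A → ¬ Simple A → length A ≡ suc (sum A) → Tight clear A
¬Simple⇒extremal⇒Tight A ¬s A≡ with classify clear A
... | inj₁ s        = ⊥-elim (¬s s)
... | inj₂ (inj₁ t) = t
... | inj₂ (inj₂ h) = ⊥-elim (<-irrefl A≡ h)

tight-head≤1 : ∀ {L} → Tight clear L → (i : Fin (length L)) → toℕ i ≡ 0 → lookup L i ≤ 1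
tight-head≤1 (0∷ t) fzero _ = z≤n
tight-head≤1 (1∷ t) fzero _ = ≤-refl

tight-head≢2 : ∀ {L} → Tight clear L → (i : Fin (length L)) → toℕ i ≡ 0 → ¬ lookup L i ≡ 2
tight-head≢2 (0∷ t) fzero _ ()
tight-head≢2 (1∷ t) fzero _ ()

tight-last≤1 : ∀ {c L} → Tight c L → (i : Fin (length L)) → suc (toℕ i) ≡ length L → lookup L i ≤ 1
tight-last≤1 (0∷ t)      fzero    _ = z≤n
tight-last≤1 (1∷ t)      fzero    _ = ≤-refl
tight-last≤1 (2∷ (0∷ t)) fzero    ()
tight-last≤1 (2∷ (1∷ t)) fzero    ()
tight-last≤1 (0∷ t)      (fsuc i) e = tight-last≤1 t i (cong pred e)
tight-last≤1 (1∷ t)      (fsuc i) e = tight-last≤1 t i (cong pred e)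
tight-last≤1 (2∷ t)      (fsuc i) e = tight-last≤1 t i (cong pred e)

tight-entries≤2 : ∀ {c L} → Tight c L → (i : Fin (length L)) → lookup L i ≤ 2
tight-entries≤2 (0∷ t) fzero    = z≤n
tight-entries≤2 (1∷ t) fzero    = s≤s z≤n
tight-entries≤2 (2∷ t) fzero    = ≤-refl
tight-entries≤2 (0∷ t) (fsuc i) = tight-entries≤2 t i
tight-entries≤2 (1∷ t) (fsuc i) = tight-entries≤2 t i
tight-entries≤2 (2∷ t) (fsuc i) = tight-entries≤2 t i

tight-no-adjacent-2s : ∀ {c L} → Tight c L → (i j : Fin (length L)) → toℕ j ≡ suc (toℕ i)
                     → ¬ (lookup L i ≡ 2 × lookup L j ≡ 2)
tight-no-adjacent-2s (0∷ t) fzero    _        _ (() , _)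
tight-no-adjacent-2s (1∷ t) fzero    _        _ (() , _)
tight-no-adjacent-2s (2∷ t) fzero    (fsuc j) e (_ , Lj≡2) = tight-head≢2 t j (cong pred e) Lj≡2
tight-no-adjacent-2s (0∷ t) (fsuc i) (fsuc j) e = tight-no-adjacent-2s t i j (cong pred e)
tight-no-adjacent-2s (1∷ t) (fsuc i) (fsuc j) e = tight-no-adjacent-2s t i j (cong pred e)
tight-no-adjacent-2s (2∷ t) (fsuc i) (fsuc j) e = tight-no-adjacent-2s t i j (cong pred e)

lemma6 : (k : ℕ)
    → ((A : List ℕ) → sum A ≡ k → k + 2 ≤ length A → Simple A)
    × ((A : List ℕ) → sum A ≡ k → length A ≡ suc k → ¬ Simple A
    → ((i : Fin (length A)) → toℕ i ≡ 0 → lookup A i ≤ 1)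
    × ((i : Fin (length A)) → toℕ i ≡ k → lookup A i ≤ 1)
    × ((i : Fin (length A)) → 1 ≤ toℕ i → toℕ i < k → lookup A i ≤ 2)
    × ((i j : Fin (length A)) → toℕ j ≡ suc (toℕ i)
    → ¬ (lookup A i ≡ 2 × lookup A j ≡ 2)))
lemma6 k = long⇒Simple , extremal-shape
  where
  long⇒Simple : (A : List ℕ) → sum A ≡ k → k + 2 ≤ length A → Simple A
  long⇒Simple A refl long with Simple⊎length≤ A
  ... | inj₁ s = s
  ... | inj₂ A≤ = ⊥-elim (<-irrefl refl (≤-trans (≤-trans (≤-reflexive (+-comm 2 k)) long) A≤))

  extremal-shape : (A : List ℕ) → sum A ≡ k → length A ≡ suc k → ¬ Simple A
    → ((i : Fin (length A)) → toℕ i ≡ 0 → lookup A i ≤ 1)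
    × ((i : Fin (length A)) → toℕ i ≡ k → lookup A i ≤ 1)
    × ((i : Fin (length A)) → 1 ≤ toℕ i → toℕ i < k → lookup A i ≤ 2)
    × ((i j : Fin (length A)) → toℕ j ≡ suc (toℕ i) → ¬ (lookup A i ≡ 2 × lookup A j ≡ 2))
  extremal-shape A refl A≡ ¬s =
      tight-head≤1 t
    , (λ i i≡k → tight-last≤1 t i (trans (cong suc i≡k) (sym A≡)))
    , (λ i _ _ → tight-entries≤2 t i)
    , tight-no-adjacent-2s t
    where t = ¬Simple⇒extremal⇒Tight A ¬s A≡
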